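{- For all non-negative integers $n,k,\ell$, the number of basis partitions $\lambda=(k+\ell,\pi,\sigma)$ of $n$ (i.e. basis partitions of $n$ with Durfee square of side $k+\ell$) such that $\pi$ has exactly $\ell$ distinct part sizes equals $L_2(n,k,\ell)$.
   Context: For an ordinary partition $\lambda=\lambda_1\ge\lambda_2\ge\cdots$, its Durfee square has side $d$, where $d$ is the largest integer $i$ with $\lambda_i\ge i$ ($d=0$ for the empty partition). Writing $\lambda'$ for the conjugate partition, $\lambda$ is represented by the triple $(d,\pi,\sigma)$ where $\pi=\lambda_{d+1}+\lambda_{d+2}+\cdots$ and $\sigma=\lambda'_{d+1}+\lambda'_{d+2}+\cdots$; then $|\lambda|=d^2+|\pi|+|\sigma|$. A partition $\lambda=(d,\pi,\sigma)$ is a basis partition if $\pi$ and $\sigma$ have no part size in common. A two-color partition is a partition each of whose parts is colored red or green. $\mathcal{L}_2(n)$ is the set of two-color partitions $\lambda_1>\lambda_2>\cdots>\lambda_m$ of $n$ into numerically distinct parts such that each red part $\lambda_i$ with $i<m$ satisfies $\lambda_i-\lambda_{i+1}\ge 2$, each green part $\lambda_i$ with $i<m$ satisfies $\lambda_i-\lambda_{i+1}\ge 3$, and no part equals $1$ with green color. $L_2(n,k,\ell)$ is the number of partitions in $\mathcal{L}_2(n)$ with exactly $k$ red and $\ell$ green parts. -}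

module Defs where

open import Data.Nat using (ℕ; zero; suc; _+_; _∸_; _≡ᵇ_; _<ᵇ_; _≤ᵇ_; _⊔_)
open import Data.Bool using (Bool; true; false; _∧_; not; T)
open import Data.List using (List; []; _∷_; length; drop; filter; map; deduplicate; upTo; foldr)
open import Data.Nat.ListAction using (sum)
open import Data.Bool.ListAction using (any)
open import Data.Nat.Properties using (_≟_)
open import Data.Product using (Σ; _×_; _,_; proj₁)

allPositive : List ℕ → Bool
allPositive []       = true
allPositive (x ∷ xs) = (1 ≤ᵇ x) ∧ allPositive xs

nonIncreasing : List ℕ → Bool
nonIncreasing []           = true
nonIncreasing (x ∷ [])     = true
nonIncreasing (x ∷ y ∷ xs) = (y ≤ᵇ x) ∧ nonIncreasing (y ∷ xs)

isPartition : List ℕ → Bool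
isPartition λs = allPositive λs ∧ nonIncreasing λs

-- λ_i with 1-based index i; equals 0 beyond the last part (and for i = 0).
part : List ℕ → ℕ → ℕ
part []       _             = 0
part (x ∷ xs) zero          = 0
part (x ∷ xs) (suc zero)    = x
part (x ∷ xs) (suc (suc i)) = part xs (suc i)

-- Durfee square side: the largest i (1 ≤ i ≤ length λ) with λ_i ≥ i, or 0.
durfee : List ℕ → ℕ
durfee λs = foldr _⊔_ 0
  (map (λ i → if′ (i ≤ᵇ part λs i) i) (upTo (suc (length λs))))
  where
  if′ : Bool → ℕ → ℕ
  if′ true  i = i
  if′ false _ = 0

conj : List ℕ → List ℕ
conj λs = map (λ j → length (filter (λ x → suc j Data.Nat.≤? x) λs))
              (upTo (part λs 1))

piPart : List ℕ → List ℕ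
piPart λs = drop (durfee λs) λs

sigmaPart : List ℕ → List ℕ
sigmaPart λs = drop (durfee λs) (conj λs)

elemᵇ : ℕ → List ℕ → Bool
elemᵇ x = any (λ y → x ≡ᵇ y)

disjointᵇ : List ℕ → List ℕ → Bool
disjointᵇ []       ys = true
disjointᵇ (x ∷ xs) ys = not (elemᵇ x ys) ∧ disjointᵇ xs ys

isBasis : List ℕ → Bool
isBasis λs = disjointᵇ (piPart λs) (sigmaPart λs)

distinctSizes : List ℕ → ℕ
distinctSizes xs = length (deduplicate _≟_ xs)

BasisSet : ℕ → ℕ → ℕ → Set
BasisSet n k ℓ = Σ (List ℕ) λ λs →
  T (isPartition λs ∧ (sum λs ≡ᵇ n) ∧ (durfee λs ≡ᵇ (k + ℓ))
     ∧ isBasis λs ∧ (distinctSizes (piPart λs) ≡ᵇ ℓ))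

data Color : Set where
  red green : Color

-- a two-colour part: (size, colour); lists are read λ₁ > λ₂ > ⋯ > λₘ
CPart : Set
CPart = ℕ × Color

size : CPart → ℕ
size (x , _) = x

-- required gap after a part of the given colour
gap : Color → ℕ
gap red   = 2
gap green = 3

notGreenOne : CPart → Bool
notGreenOne (x , red)   = true
notGreenOne (x , green) = not (x ≡ᵇ 1)

isL2 : List CPart → Bool
isL2 []                   = true
isL2 ((x , c) ∷ [])       = (1 ≤ᵇ x) ∧ notGreenOne (x , c)
isL2 ((x , c) ∷ (y , d) ∷ ps) =
  (1 ≤ᵇ x) ∧ notGreenOne (x , c) ∧ ((y + gap c) ≤ᵇ x) ∧ isL2 ((y , d) ∷ ps)

isRed : CPart → Bool
isRed (_ , red)   = true
isRed (_ , green) = false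

isGreen : CPart → Bool
isGreen (_ , red)   = false
isGreen (_ , green) = true

csum : List CPart → ℕ
csum ps = sum (map size ps)

numRed : List CPart → ℕ
numRed ps = length (filter (λ p → Data.Bool._≟_ (isRed p) true) ps)

numGreen : List CPart → ℕ
numGreen ps = length (filter (λ p → Data.Bool._≟_ (isGreen p) true) ps)

L2Set : ℕ → ℕ → ℕ → Set
L2Set n k ℓ = Σ (List CPart) λ ps →
  T (isL2 ps ∧ (csum ps ≡ᵇ n) ∧ (numRed ps ≡ᵇ k) ∧ (numGreen ps ≡ᵇ ℓ))

-- Both sides are in bijection with codes: for j = 1, …, d a colour and a count mⱼ,
-- weighted by d² + ∑ⱼ j μⱼ where μⱼ is mⱼ for red and mⱼ + 1 for green.
-- For a basis partition (d, π, σ) all parts of π and σ are at most d and no size lies in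
-- both, so size j is recorded green when π has μⱼ parts j and red when σ has μⱼ; the
-- green entries count the distinct sizes of π, and λ is recovered by stacking the rows
-- d + (sᵢ + ⋯ + s_d), sⱼ the multiplicities of σ, over π.
-- In 𝓛₂ with d parts, the j-th largest part exceeds the next one (a part −1 after the
-- smallest, which turns "no green 1" into a gap condition) by its gap plus mⱼ, that is by
-- 2 + μⱼ; so the parts are 2(d − j) + 1 + μⱼ + ⋯ + μ_d, which sum to d² + ∑ⱼ j μⱼ.
module Submission where

open import Defs
open import Data.Bool using (Bool; true; false; T; _∧_; _∨_; not)
open import Data.Bool.Properties
  using (T-∧; T-≡; T-irrelevant; ∧-assoc; ∧-zeroʳ; ∨-assoc; ∨-identityʳ; ∨-zeroʳ)
open import Data.Empty using (⊥-elim)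
open import Data.List
  using (List; []; _∷_; _++_; length; map; filter; replicate; take; drop; foldr; applyUpTo; deduplicate)
open import Data.List.Properties
  using (foldr-preservesᵇ; foldr-forcesᵇ; length-++; length-map; length-replicate; map-++; map-∘; map-id;
         filter-++; filter-all; filter-none; filter-accept; filter-reject; ++-identityʳ;
         map-upTo; map-applyUpTo; length-applyUpTo; map-cong; length-take; take++drop≡id)
open import Data.List.Relation.Unary.All as All using (All; []; _∷_)
import Data.List.Relation.Unary.All.Properties as All
open import Data.List.Relation.Unary.Linked as Linked using (Linked; []; [-]; _∷_)
import Data.List.Relation.Unary.Linked.Properties as Linked
open import Data.Nat
open import Data.Nat.ListAction using (sum)
open import Data.Nat.ListAction.Properties using (sum-++)
open import Data.Nat.Properties
open import Data.Nat.Tactic.RingSolver using (solve-∀)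
open import Data.Product using (Σ; _×_; _,_; proj₁; proj₂)
open import Data.Product.Properties using (Σ-≡,≡→≡)
open import Data.Sum using (_⊎_; inj₁; inj₂)
open import Function using (_∘_; id; flip; Equivalence)
open import Function.Bundles using (_↔_; mk↔ₛ′)
open import Function.Properties.Inverse using (↔-trans; ↔-sym)
open import Relation.Binary.PropositionalEquality
open import Relation.Nullary using (yes; no; ¬?)

T-∧⁻ : ∀ {a b} → T (a ∧ b) → T a × T b
T-∧⁻ = Equivalence.to T-∧

T-∧⁺ : ∀ {a b} → T a → T b → T (a ∧ b)
T-∧⁺ ta tb = Equivalence.from T-∧ (ta , tb)

+-≡ᵇ-∧ : ∀ r g k ℓ → (r + g ≡ᵇ k + ℓ) ∧ (g ≡ᵇ ℓ) ≡ (r ≡ᵇ k) ∧ (g ≡ᵇ ℓ)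
+-≡ᵇ-∧ r zero    k zero    rewrite +-identityʳ r | +-identityʳ k = refl
+-≡ᵇ-∧ r zero    k (suc ℓ) = trans (∧-zeroʳ _) (sym (∧-zeroʳ _))
+-≡ᵇ-∧ r (suc g) k zero    = trans (∧-zeroʳ _) (sym (∧-zeroʳ _))
+-≡ᵇ-∧ r (suc g) k (suc ℓ) rewrite +-suc r g | +-suc k ℓ = +-≡ᵇ-∧ r g k ℓ

Σ-T-↔ : {A B : Set} {P : A → Bool} {Q : B → Bool} (f : A → B) (g : B → A) →
        (∀ a → Q (f a) ≡ P a) → (∀ a → g (f a) ≡ a) → (∀ {b} → T (Q b) → f (g b) ≡ b) →
        Σ A (T ∘ P) ↔ Σ B (T ∘ Q)
Σ-T-↔ {Q = Q} f g Q∘f≡P g∘f≡id f∘g≡id = mk↔ₛ′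
  (λ (a , pa) → f a , subst T (sym (Q∘f≡P a)) pa)
  (λ (b , qb) → g b , subst T (trans (cong Q (sym (f∘g≡id qb))) (Q∘f≡P (g b))) qb)
  (λ (b , qb) → Σ-≡,≡→≡ (f∘g≡id qb , T-irrelevant _ _))
  (λ (a , pa) → Σ-≡,≡→≡ (g∘f≡id a , T-irrelevant _ _))


+-interchange : ∀ a b c d → (a + b) + (c + d) ≡ (a + c) + (b + d)
+-interchange = solve-∀

sum-map-+ : ∀ {A : Set} (f g : A → ℕ) xs → sum (map (λ x → f x + g x) xs) ≡ sum (map f xs) + sum (map g xs)
sum-map-+ f g []       = refl
sum-map-+ f g (x ∷ xs) =
  trans (cong (f x + g x +_) (sum-map-+ f g xs)) (+-interchange (f x) (g x) (sum (map f xs)) (sum (map g xs)))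

sum-map-shift : ∀ d xs → sum (map (d +_) xs) ≡ length xs * d + sum xs
sum-map-shift d []       = refl
sum-map-shift d (x ∷ xs) = begin
  d + x + sum (map (d +_) xs)      ≡⟨ cong (d + x +_) (sum-map-shift d xs) ⟩
  d + x + (length xs * d + sum xs) ≡⟨ rearrange d x (length xs) (sum xs) ⟩
  suc (length xs) * d + (x + sum xs) ∎
  where
  open ≡-Reasoning
  rearrange : ∀ d x l s → d + x + (l * d + s) ≡ suc l * d + (x + s)
  rearrange = solve-∀

sum-replicate-1 : ∀ n → sum (replicate n 1) ≡ n
sum-replicate-1 zero    = refl
sum-replicate-1 (suc n) = cong suc (sum-replicate-1 n)

take-++ : ∀ {n} (xs ys : List ℕ) → length xs ≡ n → take n (xs ++ ys) ≡ xs
take-++ []       ys refl = refl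
take-++ (x ∷ xs) ys refl = cong (x ∷_) (take-++ xs ys refl)

drop-++ : ∀ {n} (xs ys : List ℕ) → length xs ≡ n → drop n (xs ++ ys) ≡ ys
drop-++ []       ys refl = refl
drop-++ (x ∷ xs) ys refl = drop-++ xs ys refl

map-∸-+ : ∀ d xs → map (_∸ d) (map (d +_) xs) ≡ xs
map-∸-+ d xs = trans (sym (map-∘ xs)) (trans (map-cong (m+n∸m≡n d) xs) (map-id xs))

map-+-∸ : ∀ {d xs} → All (d ≤_) xs → map (d +_) (map (_∸ d) xs) ≡ xs
map-+-∸ []         = refl
map-+-∸ (d≤x ∷ ps) = cong₂ _∷_ (m+[n∸m]≡n d≤x) (map-+-∸ ps)

applyUpTo-+ : ∀ (f : ℕ → ℕ) m n → applyUpTo f (m + n) ≡ applyUpTo f m ++ applyUpTo (f ∘ (m +_)) n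
applyUpTo-+ f zero    n = refl
applyUpTo-+ f (suc m) n = cong (f 0 ∷_) (applyUpTo-+ (f ∘ suc) m n)

applyUpTo-cong : ∀ {f g : ℕ → ℕ} n → (∀ {i} → i < n → f i ≡ g i) → applyUpTo f n ≡ applyUpTo g n
applyUpTo-cong zero    _  = refl
applyUpTo-cong (suc n) eq = cong₂ _∷_ (eq (s≤s z≤n)) (applyUpTo-cong n (eq ∘ s≤s))

applyUpTo-const : ∀ (x : ℕ) n → applyUpTo (λ _ → x) n ≡ replicate n x
applyUpTo-const x zero    = refl
applyUpTo-const x (suc n) = cong (x ∷_) (applyUpTo-const x n)

suffixSums : List ℕ → List ℕ
suffixSums []          = []
suffixSums xs@(_ ∷ ys) = sum xs ∷ suffixSums ys

length-suffixSums : ∀ s → length (suffixSums s) ≡ length s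
length-suffixSums []      = refl
length-suffixSums (_ ∷ s) = cong suc (length-suffixSums s)

part₁-suffixSums : ∀ s → part (suffixSums s) 1 ≡ sum s
part₁-suffixSums []      = refl
part₁-suffixSums (_ ∷ _) = refl

-- ∑ⱼ j xⱼ over the positions j = 1, 2, …
weight : List ℕ → ℕ
weight xs = sum (suffixSums xs)

weight-map-+ : ∀ {A : Set} (f g : A → ℕ) xs →
               weight (map (λ x → f x + g x) xs) ≡ weight (map f xs) + weight (map g xs)
weight-map-+ f g []       = refl
weight-map-+ f g (x ∷ xs) = begin
  sum (map h (x ∷ xs)) + weight (map h xs)
    ≡⟨ cong₂ _+_ (sum-map-+ f g (x ∷ xs)) (weight-map-+ f g xs) ⟩
  (sum (map f (x ∷ xs)) + sum (map g (x ∷ xs))) + (weight (map f xs) + weight (map g xs))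
    ≡⟨ +-interchange (sum (map f (x ∷ xs))) _ _ _ ⟩
  (sum (map f (x ∷ xs)) + weight (map f xs)) + (sum (map g (x ∷ xs)) + weight (map g xs))
    ∎
  where
  open ≡-Reasoning
  h = λ x → f x + g x

differences : List ℕ → List ℕ
differences []       = []
differences (x ∷ xs) = (x ∸ part xs 1) ∷ differences xs

length-differences : ∀ xs → length (differences xs) ≡ length xs
length-differences []       = refl
length-differences (_ ∷ xs) = cong suc (length-differences xs)

differences-suffixSums : ∀ s → differences (suffixSums s) ≡ s
differences-suffixSums []      = refl
differences-suffixSums (v ∷ s) = cong₂ _∷_
  (trans (cong (v + sum s ∸_) (part₁-suffixSums s)) (m+n∸n≡m v (sum s)))
  (differences-suffixSums s)


-- Codes

Code : Set
Code = List (ℕ × Color)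

extra : Color → ℕ
extra red   = 0
extra green = 1

gap≡2+extra : ∀ c → gap c ≡ 2 + extra c
gap≡2+extra red   = refl
gap≡2+extra green = refl

mult : ℕ × Color → ℕ
mult (m , c) = extra c + m

isCodeOf : ℕ → ℕ → ℕ → Code → Bool
isCodeOf n k ℓ D = (length D * length D + weight (map mult D) ≡ᵇ n) ∧ (numRed D ≡ᵇ k) ∧ (numGreen D ≡ᵇ ℓ)

CodeSet : ℕ → ℕ → ℕ → Set
CodeSet n k ℓ = Σ Code (T ∘ isCodeOf n k ℓ)

length≡numRed+numGreen : ∀ D → length D ≡ numRed D + numGreen D
length≡numRed+numGreen []                = refl
length≡numRed+numGreen ((_ , red)   ∷ D) = cong suc (length≡numRed+numGreen D)
length≡numRed+numGreen ((_ , green) ∷ D) =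
  trans (cong suc (length≡numRed+numGreen D)) (sym (+-suc (numRed D) (numGreen D)))


-- Two-colour partitions

-- one more than the largest part, reading an empty list as a single part −1
top : List CPart → ℕ
top []            = 0
top ((x , _) ∷ _) = suc x

toL2 : Code → List CPart
toL2 []              = []
toL2 (e@(_ , c) ∷ D) = (suc (mult e + top (toL2 D)) , c) ∷ toL2 D

fromL2 : List CPart → Code
fromL2 []             = []
fromL2 ((x , c) ∷ ps) = (suc x ∸ (gap c + top ps) , c) ∷ fromL2 ps

toL2-gap : ∀ m c y → y + gap c ≤ suc (mult (m , c) + suc y)
toL2-gap m c y = begin
  y + gap c                  ≡⟨ cong (y +_) (gap≡2+extra c) ⟩
  y + (2 + extra c)          ≤⟨ m≤n+m _ m ⟩
  m + (y + (2 + extra c))    ≡⟨ rearrange (extra c) m y ⟩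
  suc (extra c + m + suc y)  ∎
  where
  open ≤-Reasoning
  rearrange : ∀ e m y → m + (y + (2 + e)) ≡ suc (e + m + suc y)
  rearrange = solve-∀

toL2-isL2 : ∀ D → T (isL2 (toL2 D))
toL2-isL2 []                    = _
toL2-isL2 ((m , red)   ∷ [])    = _
toL2-isL2 ((m , green) ∷ [])    = _
toL2-isL2 ((m , red)   ∷ e ∷ D) = T-∧⁺ (≤⇒≤ᵇ (toL2-gap m red   (suc (mult e + top (toL2 D))))) (toL2-isL2 (e ∷ D))
toL2-isL2 ((m , green) ∷ e ∷ D) = T-∧⁺ (≤⇒≤ᵇ (toL2-gap m green (suc (mult e + top (toL2 D))))) (toL2-isL2 (e ∷ D))

≤ᵇ⇒+suc≤suc : ∀ {g x y} → T (y + g ≤ᵇ x) → g + suc y ≤ suc x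
≤ᵇ⇒+suc≤suc {g} {x} {y} t = begin
  g + suc y    ≡⟨ +-suc g y ⟩
  suc (g + y)  ≡⟨ cong suc (+-comm g y) ⟩
  suc (y + g)  ≤⟨ s≤s (≤ᵇ⇒≤ (y + g) x t) ⟩
  suc x        ∎
  where open ≤-Reasoning

isL2-∷ : ∀ {x c} ps → T (isL2 ((x , c) ∷ ps)) → gap c + top ps ≤ suc x × T (isL2 ps)
isL2-∷ {zero}        {red}   []            ()
isL2-∷ {zero}        {green} []            ()
isL2-∷ {suc x}       {red}   []            _ = s≤s (s≤s z≤n) , _
isL2-∷ {suc zero}    {green} []            ()
isL2-∷ {suc (suc x)} {green} []            _ = s≤s (s≤s (s≤s z≤n)) , _
isL2-∷ {zero}                (_ ∷ _)       ()
isL2-∷ {suc x}       {red}   ((y , _) ∷ _) t = let le , tl = T-∧⁻ t in ≤ᵇ⇒+suc≤suc {2} {y = y} le , tl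
isL2-∷ {suc zero}    {green} (_ ∷ _)       ()
isL2-∷ {suc (suc x)} {green} ((y , _) ∷ _) t = let le , tl = T-∧⁻ t in ≤ᵇ⇒+suc≤suc {3} {y = y} le , tl

toL2-excess : ∀ m c t → suc (suc (mult (m , c) + t)) ∸ (gap c + t) ≡ m
toL2-excess m red   t = m+n∸n≡m m t
toL2-excess m green t = m+n∸n≡m m t

fromL2-toL2 : ∀ D → fromL2 (toL2 D) ≡ D
fromL2-toL2 []            = refl
fromL2-toL2 ((m , c) ∷ D) =
  cong₂ _∷_ (cong (_, c) (toL2-excess m c (top (toL2 D)))) (fromL2-toL2 D)

∸-refill : ∀ {g x} e t → g ≡ 2 + e → g + t ≤ suc x → suc (e + (suc x ∸ (g + t)) + t) ≡ x
∸-refill {x = x} e t refl le =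
  suc-injective (trans (rearrange e t (suc x ∸ (2 + e + t))) (m∸n+n≡m le))
  where
  rearrange : ∀ e t u → suc (suc (e + u + t)) ≡ u + (2 + e + t)
  rearrange = solve-∀

toL2-fromL2 : ∀ ps → T (isL2 ps) → toL2 (fromL2 ps) ≡ ps
toL2-fromL2 []             _ = refl
toL2-fromL2 ((x , c) ∷ ps) t = cong₂ _∷_ (cong (_, c) size≡x) (toL2-fromL2 ps tl)
  where
  room = proj₁ (isL2-∷ ps t)
  tl = proj₂ (isL2-∷ ps t)
  m = suc x ∸ (gap c + top ps)
  size≡x : suc (mult (m , c) + top (toL2 (fromL2 ps))) ≡ x
  size≡x = begin
    suc (extra c + m + top (toL2 (fromL2 ps)))  ≡⟨ cong (λ ps′ → suc (extra c + m + top ps′)) (toL2-fromL2 ps tl) ⟩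
    suc (extra c + m + top ps)                  ≡⟨ ∸-refill (extra c) (top ps) (gap≡2+extra c) room ⟩
    x                                           ∎
    where open ≡-Reasoning

top-toL2 : ∀ D → top (toL2 D) ≡ length D + length D + sum (map mult D)
top-toL2 []      = refl
top-toL2 (e ∷ D) = begin
  suc (suc (mult e + top (toL2 D)))                           ≡⟨ cong (λ t → suc (suc (mult e + t))) (top-toL2 D) ⟩
  suc (suc (mult e + (length D + length D + sum (map mult D)))) ≡⟨ rearrange (mult e) (length D) (sum (map mult D)) ⟩
  suc (length D) + suc (length D) + (mult e + sum (map mult D)) ∎
  where
  open ≡-Reasoning
  rearrange : ∀ v l s → suc (suc (v + (l + l + s))) ≡ suc l + suc l + (v + s)
  rearrange = solve-∀

csum-toL2 : ∀ D → csum (toL2 D) ≡ length D * length D + weight (map mult D)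
csum-toL2 []      = refl
csum-toL2 (e ∷ D) = begin
  suc (mult e + top (toL2 D)) + csum (toL2 D)
    ≡⟨ cong₂ (λ t w → suc (mult e + t) + w) (top-toL2 D) (csum-toL2 D) ⟩
  suc (mult e + (l + l + s)) + (l * l + weight (map mult D))
    ≡⟨ rearrange (mult e) l s (weight (map mult D)) ⟩
  suc l * suc l + (mult e + s + weight (map mult D))
    ∎
  where
  open ≡-Reasoning
  l = length D
  s = sum (map mult D)
  rearrange : ∀ v l s w → suc (v + (l + l + s)) + (l * l + w) ≡ suc l * suc l + (v + s + w)
  rearrange = solve-∀

numRed-toL2 : ∀ D → numRed (toL2 D) ≡ numRed D
numRed-toL2 []                = refl
numRed-toL2 ((_ , red)   ∷ D) = cong suc (numRed-toL2 D)
numRed-toL2 ((_ , green) ∷ D) = numRed-toL2 D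

numGreen-toL2 : ∀ D → numGreen (toL2 D) ≡ numGreen D
numGreen-toL2 []                = refl
numGreen-toL2 ((_ , red)   ∷ D) = numGreen-toL2 D
numGreen-toL2 ((_ , green) ∷ D) = cong suc (numGreen-toL2 D)

isL2Of : ℕ → ℕ → ℕ → List CPart → Bool
isL2Of n k ℓ ps = isL2 ps ∧ (csum ps ≡ᵇ n) ∧ (numRed ps ≡ᵇ k) ∧ (numGreen ps ≡ᵇ ℓ)

isL2Of-toL2 : ∀ n k ℓ D → isL2Of n k ℓ (toL2 D) ≡ isCodeOf n k ℓ D
isL2Of-toL2 n k ℓ D
  rewrite Equivalence.to T-≡ (toL2-isL2 D) | csum-toL2 D | numRed-toL2 D | numGreen-toL2 D = refl

CodeSet↔L2Set : ∀ n k ℓ → CodeSet n k ℓ ↔ L2Set n k ℓ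
CodeSet↔L2Set n k ℓ = Σ-T-↔ toL2 fromL2 (isL2Of-toL2 n k ℓ) fromL2-toL2
  (λ {ps} t → toL2-fromL2 ps (proj₁ (T-∧⁻ t)))


-- Sorted lists and the Durfee square

allPositive⇒All : ∀ xs → T (allPositive xs) → All (1 ≤_) xs
allPositive⇒All []       _ = []
allPositive⇒All (x ∷ xs) t = let p , ps = T-∧⁻ t in ≤ᵇ⇒≤ 1 x p ∷ allPositive⇒All xs ps

All⇒allPositive : ∀ {xs} → All (1 ≤_) xs → T (allPositive xs)
All⇒allPositive []       = _
All⇒allPositive (p ∷ ps) = T-∧⁺ (≤⇒≤ᵇ p) (All⇒allPositive ps)

nonIncreasing⇒Linked : ∀ xs → T (nonIncreasing xs) → Linked _≥_ xs
nonIncreasing⇒Linked []           _ = []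
nonIncreasing⇒Linked (x ∷ [])     _ = [-]
nonIncreasing⇒Linked (x ∷ y ∷ xs) t =
  let le , t′ = T-∧⁻ t in ≤ᵇ⇒≤ y x le ∷ nonIncreasing⇒Linked (y ∷ xs) t′

Linked⇒nonIncreasing : ∀ {xs} → Linked _≥_ xs → T (nonIncreasing xs)
Linked⇒nonIncreasing []       = _
Linked⇒nonIncreasing [-]      = _
Linked⇒nonIncreasing (r ∷ rs) = T-∧⁺ (≤⇒≤ᵇ r) (Linked⇒nonIncreasing rs)

Linked-++ : ∀ {m xs ys} → Linked _≥_ xs → Linked _≥_ ys → All (m ≤_) xs → All (_≤ m) ys →
            Linked _≥_ (xs ++ ys)
Linked-++              []        lys _          _         = lys
Linked-++ {ys = []}    [-]       _   _          _         = [-]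
Linked-++ {ys = _ ∷ _} [-]       lys (m≤x ∷ []) (y≤m ∷ _) = ≤-trans y≤m m≤x ∷ lys
Linked-++              (r ∷ lxs) lys (_ ∷ m≤xs) ys≤m      = r ∷ Linked-++ lxs lys m≤xs ys≤m

replicate-sorted : ∀ n {x} → Linked _≥_ (replicate n x)
replicate-sorted zero          = []
replicate-sorted (suc zero)    = [-]
replicate-sorted (suc (suc n)) = ≤-refl ∷ replicate-sorted (suc n)

take-sorted : ∀ n {xs} → Linked _≥_ xs → Linked _≥_ (take n xs)
take-sorted zero          _       = []
take-sorted (suc n)       []      = []
take-sorted (suc zero)    [-]     = [-]
take-sorted (suc zero)    (_ ∷ _) = [-]
take-sorted (suc (suc n)) [-]     = [-]
take-sorted (suc (suc n)) (r ∷ l) = r ∷ take-sorted (suc n) l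

drop-sorted : ∀ n {xs} → Linked _≥_ xs → Linked _≥_ (drop n xs)
drop-sorted zero    l       = l
drop-sorted (suc n) []      = []
drop-sorted (suc n) [-]     = drop-sorted n []
drop-sorted (suc n) (_ ∷ l) = drop-sorted n l

part-++ˡ : ∀ xs ys {i} → i < length xs → part (xs ++ ys) (suc i) ≡ part xs (suc i)
part-++ˡ (x ∷ xs) ys {zero}  _         = refl
part-++ˡ (x ∷ xs) ys {suc i} (s≤s i<l) = part-++ˡ xs ys i<l

part-++ʳ : ∀ xs ys j → part (xs ++ ys) (suc (length xs + j)) ≡ part ys (suc j)
part-++ʳ []       ys j = refl
part-++ʳ (x ∷ xs) ys j = part-++ʳ xs ys j

All-part : ∀ {P : ℕ → Set} {xs i} → All P xs → i < length xs → P (part xs (suc i))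
All-part {i = zero}  (p ∷ _)  _         = p
All-part {i = suc i} (_ ∷ ps) (s≤s i<l) = All-part ps i<l

part-beyond : ∀ xs {i} → length xs ≤ i → part xs (suc i) ≡ 0
part-beyond []               _         = refl
part-beyond (x ∷ xs) {suc i} (s≤s l≤i) = part-beyond xs l≤i

All-≤-part : ∀ {m xs} → All (_≤ m) xs → ∀ i → part xs i ≤ m
All-≤-part []       _             = z≤n
All-≤-part (_ ∷ _)  zero          = z≤n
All-≤-part (p ∷ _)  (suc zero)    = p
All-≤-part (_ ∷ ps) (suc (suc i)) = All-≤-part ps (suc i)

part>0⇒< : ∀ xs {i} → 0 < part xs (suc i) → i < length xs
part>0⇒< (x ∷ xs) {zero}  _ = s≤s z≤n
part>0⇒< (x ∷ xs) {suc i} p = s≤s (part>0⇒< xs p)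

part-≤-head : ∀ {x xs i} → Linked _≥_ (x ∷ xs) → part xs (suc i) ≤ x
part-≤-head {xs = []}             [-]       = z≤n
part-≤-head {xs = y ∷ xs} {zero}  (x≥y ∷ _) = x≥y
part-≤-head {xs = y ∷ xs} {suc i} (x≥y ∷ l) = ≤-trans (part-≤-head l) x≥y

part-anti : ∀ {xs i j} → Linked _≥_ xs → i ≤ j → part xs (suc j) ≤ part xs (suc i)
part-anti {[]}                     _ _         = z≤n
part-anti {x ∷ xs} {zero}  {zero}  _ _         = ≤-refl
part-anti {x ∷ xs} {zero}  {suc j} l _         = part-≤-head l
part-anti {x ∷ xs} {suc i} {suc j} l (s≤s i≤j) = part-anti (Linked.tail l) i≤j

take-≥-part : ∀ {xs} → Linked _≥_ xs → ∀ i → All (part xs i ≤_) (take i xs)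
take-≥-part          _ zero          = []
take-≥-part {[]}     _ (suc i)       = []
take-≥-part {x ∷ xs} _ (suc zero)    = ≤-refl ∷ []
take-≥-part {x ∷ xs} l (suc (suc i)) = part-≤-head l ∷ take-≥-part (Linked.tail l) (suc i)

drop-≤-part : ∀ {xs} → Linked _≥_ xs → ∀ i → All (_≤ part xs (suc i)) (drop i xs)
drop-≤-part {[]}     _ zero    = []
drop-≤-part {[]}     _ (suc i) = []
drop-≤-part {x ∷ xs} l zero    = Linked.Linked⇒All (flip ≤-trans) ≤-refl l
drop-≤-part {x ∷ xs} l (suc i) = drop-≤-part (Linked.tail l) i

DurfeeSide : List ℕ → ℕ → Set
DurfeeSide xs d = d ≤ part xs d × part xs (suc d) ≤ d

-- `durfee` maps a helper local to Defs over the candidates 0, …, length xs; unifying the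
-- unfolded `durfee xs`, in which candidate 0 has reduced away, with such a map names it.
durfeeCandidate : List ℕ → ℕ → ℕ
durfeeCandidate xs = mapped refl
  where
  mapped : ∀ {f} → durfee xs ≡ foldr _⊔_ 0 (map f (applyUpTo suc (length xs))) → ℕ → ℕ
  mapped {f} _ = f

durfeeCandidate-spec : ∀ xs j → (j ≤ part xs j × durfeeCandidate xs j ≡ j)
                                ⊎ (part xs j < j × durfeeCandidate xs j ≡ 0)
durfeeCandidate-spec xs j with j ≤ᵇ part xs j in test
... | true  = inj₁ (≤ᵇ⇒≤ j (part xs j) (subst T (sym test) _) , refl)
... | false = inj₂ (≰⇒> (λ j≤ → subst T test (≤⇒≤ᵇ j≤)) , refl)

durfee-side : ∀ xs → DurfeeSide xs (durfee xs)
durfee-side xs = side≤part , part≤side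
  where
  L = length xs
  candidates = map (durfeeCandidate xs) (applyUpTo suc L)
  M = durfee xs

  Fits : ℕ → Set
  Fits m = m ≤ part xs m

  candidate-fits : ∀ i → Fits (durfeeCandidate xs (suc i))
  candidate-fits i with durfeeCandidate-spec xs (suc i)
  ... | inj₁ (fits , eq) = subst Fits (sym eq) fits
  ... | inj₂ (_    , eq) = subst Fits (sym eq) z≤n

  ⊔-fits : ∀ {a b} → Fits a → Fits b → Fits (a ⊔ b)
  ⊔-fits {a} {b} fa fb with ⊔-sel a b
  ... | inj₁ eq = subst Fits (sym eq) fa
  ... | inj₂ eq = subst Fits (sym eq) fb

  side≤part : Fits M
  side≤part = foldr-preservesᵇ {P = Fits} ⊔-fits z≤n (All.map⁺ (All.applyUpTo⁺₂ suc L candidate-fits))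

  candidates≤M : All (_≤ M) candidates
  candidates≤M = foldr-forcesᵇ (λ a b le → m⊔n≤o⇒m≤o a b le , m⊔n≤o⇒n≤o a b le) 0 candidates ≤-refl

  part≤side : part xs (suc M) ≤ M
  part≤side with M <? L
  ... | no  M≮L = subst (_≤ M) (sym (part-beyond xs (≮⇒≥ M≮L))) z≤n
  ... | yes M<L with durfeeCandidate-spec xs (suc M)
                   | All.applyUpTo⁻ suc L (All.map⁻ candidates≤M) M<L
  ...   | inj₁ (_ , eq) | cand≤M = ⊥-elim (<-irrefl refl (subst (_≤ M) eq cand≤M))
  ...   | inj₂ (lt , _) | _      = ≤-pred lt

DurfeeSide-≤ : ∀ {xs d e} → Linked _≥_ xs → DurfeeSide xs d → DurfeeSide xs e → d ≤ e
DurfeeSide-≤ {d = zero}       _ _            _            = z≤n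
DurfeeSide-≤ {d = suc d′} {e} l (d≤part , _) (_ , part≤e) = ≮⇒≥ λ e<d →
  <⇒≱ e<d (≤-trans d≤part (≤-trans (part-anti l (≤-pred e<d)) part≤e))

durfee-unique : ∀ {xs d} → Linked _≥_ xs → DurfeeSide xs d → durfee xs ≡ d
durfee-unique {xs} l side = ≤-antisym (DurfeeSide-≤ l (durfee-side xs) side) (DurfeeSide-≤ l side (durfee-side xs))

DurfeeSide-++ : ∀ {xs ys d} → length xs ≡ d → All (d ≤_) xs → All (_≤ d) ys → DurfeeSide (xs ++ ys) d
DurfeeSide-++ {xs} {ys} {d} len d≤xs ys≤d = d≤part d len d≤xs , part≤d
  where
  open ≤-Reasoning
  d≤part : ∀ d → length xs ≡ d → All (d ≤_) xs → d ≤ part (xs ++ ys) d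
  d≤part zero     _   _    = z≤n
  d≤part (suc d′) len d≤xs = begin
    suc d′                    ≤⟨ All-part d≤xs d′<len ⟩
    part xs (suc d′)          ≡⟨ part-++ˡ xs ys d′<len ⟨
    part (xs ++ ys) (suc d′)  ∎
    where d′<len = ≤-reflexive (sym len)
  part≤d : part (xs ++ ys) (suc d) ≤ d
  part≤d = begin
    part (xs ++ ys) (suc d)                ≡⟨ cong (λ i → part (xs ++ ys) (suc i)) (trans (sym len) (sym (+-identityʳ _))) ⟩
    part (xs ++ ys) (suc (length xs + 0))  ≡⟨ part-++ʳ xs ys 0 ⟩
    part ys 1                              ≤⟨ All-≤-part ys≤d 1 ⟩
    d                                      ∎

DurfeeSide-length : ∀ {xs d} → DurfeeSide xs d → d ≤ length xs
DurfeeSide-length {xs} {zero}   _            = z≤n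
DurfeeSide-length {xs} {suc d′} (d≤part , _) = part>0⇒< xs (≤-trans (s≤s z≤n) d≤part)


suffixSums-sorted : ∀ s → Linked _≥_ (suffixSums s)
suffixSums-sorted []          = []
suffixSums-sorted (v ∷ [])    = [-]
suffixSums-sorted (v ∷ w ∷ s) = m≤n+m (sum (w ∷ s)) v ∷ suffixSums-sorted (w ∷ s)

suffixSums-bounded : ∀ s → All (_≤ sum s) (suffixSums s)
suffixSums-bounded []      = []
suffixSums-bounded (v ∷ s) = ≤-refl ∷ All.map (λ le → ≤-trans le (m≤n+m (sum s) v)) (suffixSums-bounded s)

suffixSums-differences : ∀ {xs} → Linked _≥_ xs → suffixSums (differences xs) ≡ xs
suffixSums-differences {[]}     _ = refl
suffixSums-differences {x ∷ xs} l = cong₂ _∷_ telescope ih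
  where
  ih = suffixSums-differences (Linked.tail l)
  telescope : x ∸ part xs 1 + sum (differences xs) ≡ x
  telescope = begin
    x ∸ part xs 1 + sum (differences xs)
      ≡⟨ cong (x ∸ part xs 1 +_) (part₁-suffixSums (differences xs)) ⟨
    x ∸ part xs 1 + part (suffixSums (differences xs)) 1
      ≡⟨ cong (λ ys → x ∸ part xs 1 + part ys 1) ih ⟩
    x ∸ part xs 1 + part xs 1
      ≡⟨ m∸n+n≡m (part-≤-head l) ⟩
    x ∎
    where open ≡-Reasoning

-- the partition with pⱼ parts equal to j, for p = p₁ ∷ p₂ ∷ ⋯
fromMults : List ℕ → List ℕ
fromMults []      = []
fromMults (v ∷ p) = map suc (fromMults p) ++ replicate v 1

ones : List ℕ → ℕ
ones π = length (filter (_≟ 1) π)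

dropFirstColumn : List ℕ → List ℕ
dropFirstColumn π = map pred (filter (2 ≤?_) π)

toMults : ℕ → List ℕ → List ℕ
toMults zero    _ = []
toMults (suc d) π = ones π ∷ toMults d (dropFirstColumn π)

length-toMults : ∀ d π → length (toMults d π) ≡ d
length-toMults zero    π = refl
length-toMults (suc d) π = cong suc (length-toMults d (dropFirstColumn π))

map-suc-positive : ∀ xs → All (1 ≤_) (map suc xs)
map-suc-positive xs = All.map⁺ (All.universal (λ _ → s≤s z≤n) xs)

fromMults-positive : ∀ p → All (1 ≤_) (fromMults p)
fromMults-positive []      = []
fromMults-positive (v ∷ p) = All.++⁺ (map-suc-positive (fromMults p)) (All.replicate⁺ v ≤-refl)

fromMults-bounded : ∀ p → All (_≤ length p) (fromMults p)
fromMults-bounded []      = []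
fromMults-bounded (v ∷ p) =
  All.++⁺ (All.map⁺ (All.map s≤s (fromMults-bounded p))) (All.replicate⁺ v (s≤s z≤n))

fromMults-sorted : ∀ p → Linked _≥_ (fromMults p)
fromMults-sorted []      = []
fromMults-sorted (v ∷ p) = Linked-++ (Linked.map⁺ (Linked.map s≤s (fromMults-sorted p)))
  (replicate-sorted v) (map-suc-positive (fromMults p)) (All.replicate⁺ v ≤-refl)

length-fromMults : ∀ p → length (fromMults p) ≡ sum p
length-fromMults []      = refl
length-fromMults (v ∷ p) = begin
  length (map suc (fromMults p) ++ replicate v 1)   ≡⟨ length-++ (map suc (fromMults p)) ⟩
  length (map suc (fromMults p)) + length (replicate v 1)
    ≡⟨ cong₂ _+_ (trans (length-map suc (fromMults p)) (length-fromMults p)) (length-replicate v) ⟩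
  sum p + v                                         ≡⟨ +-comm (sum p) v ⟩
  v + sum p                                         ∎
  where open ≡-Reasoning

sum-fromMults : ∀ p → sum (fromMults p) ≡ weight p
sum-fromMults []      = refl
sum-fromMults (v ∷ p) = begin
  sum (map suc (fromMults p) ++ replicate v 1)
    ≡⟨ sum-++ (map suc (fromMults p)) (replicate v 1) ⟩
  sum (map (1 +_) (fromMults p)) + sum (replicate v 1)
    ≡⟨ cong₂ _+_ (sum-map-shift 1 (fromMults p)) (sum-replicate-1 v) ⟩
  length (fromMults p) * 1 + sum (fromMults p) + v
    ≡⟨ cong₂ (λ l w → l * 1 + w + v) (length-fromMults p) (sum-fromMults p) ⟩
  sum p * 1 + weight p + v
    ≡⟨ rearrange v (sum p) (weight p) ⟩
  v + sum p + weight p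
    ∎
  where
  open ≡-Reasoning
  rearrange : ∀ v s w → s * 1 + w + v ≡ v + s + w
  rearrange = solve-∀

ones-++ : ∀ xs ys → ones (xs ++ ys) ≡ ones xs + ones ys
ones-++ xs ys = trans (cong length (filter-++ (_≟ 1) xs ys)) (length-++ (filter (_≟ 1) xs))

ones-map-suc : ∀ {xs} → All (1 ≤_) xs → ones (map suc xs) ≡ 0
ones-map-suc ps = cong length (filter-none (_≟ 1) (All.map⁺ (All.map (λ { (s≤s z≤n) () }) ps)))

ones-replicate : ∀ n → ones (replicate n 1) ≡ n
ones-replicate n = trans (cong length (filter-all (_≟ 1) (All.replicate⁺ n refl))) (length-replicate n)

dropFirstColumn-++ : ∀ xs ys → dropFirstColumn (xs ++ ys) ≡ dropFirstColumn xs ++ dropFirstColumn ys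
dropFirstColumn-++ xs ys = trans (cong (map pred) (filter-++ (2 ≤?_) xs ys)) (map-++ pred (filter (2 ≤?_) xs) _)

dropFirstColumn-map-suc : ∀ {xs} → All (1 ≤_) xs → dropFirstColumn (map suc xs) ≡ xs
dropFirstColumn-map-suc {xs} ps = begin
  map pred (filter (2 ≤?_) (map suc xs))  ≡⟨ cong (map pred) (filter-all (2 ≤?_) (All.map⁺ (All.map s≤s ps))) ⟩
  map pred (map suc xs)                   ≡⟨ map-∘ xs ⟨
  map id xs                               ≡⟨ map-id xs ⟩
  xs                                      ∎
  where open ≡-Reasoning

dropFirstColumn-replicate : ∀ n → dropFirstColumn (replicate n 1) ≡ []
dropFirstColumn-replicate n = cong (map pred) (filter-none (2 ≤?_) (All.replicate⁺ n λ { (s≤s ()) }))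

toMults-fromMults : ∀ {d} p → length p ≡ d → toMults d (fromMults p) ≡ p
toMults-fromMults []      refl = refl
toMults-fromMults (v ∷ p) refl = cong₂ _∷_ ones≡v (trans (cong (toMults (length p)) column) (toMults-fromMults p refl))
  where
  F = fromMults p
  ones≡v : ones (map suc F ++ replicate v 1) ≡ v
  ones≡v = trans (ones-++ (map suc F) _) (cong₂ _+_ (ones-map-suc (fromMults-positive p)) (ones-replicate v))
  column : dropFirstColumn (map suc F ++ replicate v 1) ≡ F
  column = trans (dropFirstColumn-++ (map suc F) _)
    (trans (cong₂ _++_ (dropFirstColumn-map-suc (fromMults-positive p)) (dropFirstColumn-replicate v)) (++-identityʳ F))

dropFirstColumn-sorted : ∀ {π} → Linked _≥_ π → Linked _≥_ (dropFirstColumn π)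
dropFirstColumn-sorted l = Linked.map⁺ (Linked.map pred-mono-≤ (Linked.filter⁺ (2 ≤?_) (flip ≤-trans) l))

dropFirstColumn-positive : ∀ π → All (1 ≤_) (dropFirstColumn π)
dropFirstColumn-positive π = All.map⁺ (All.map (λ { (s≤s (s≤s _)) → s≤s z≤n }) (All.all-filter (2 ≤?_) π))

dropFirstColumn-bounded : ∀ {m π} → All (_≤ suc m) π → All (_≤ m) (dropFirstColumn π)
dropFirstColumn-bounded b = All.map⁺ (All.map pred-mono-≤ (All.filter⁺ (2 ≤?_) b))

all-ones : ∀ {π} → All (_≡ 1) π → dropFirstColumn π ≡ [] × replicate (ones π) 1 ≡ π
all-ones []          = refl , refl
all-ones (refl ∷ qs) = let column , rest = all-ones qs in column , cong (1 ∷_) rest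

sorted-split : ∀ {π} → Linked _≥_ π → All (1 ≤_) π → map suc (dropFirstColumn π) ++ replicate (ones π) 1 ≡ π
sorted-split {[]}              _ _        = refl
sorted-split {suc zero ∷ π}    l (_ ∷ ps) = cong₂ (λ c r → map suc c ++ 1 ∷ r) column rest
  where
  ones-only = All.zipWith (λ (le , ge) → ≤-antisym le ge)
    (All.tail (Linked.Linked⇒All (flip ≤-trans) ≤-refl l) , ps)
  column = proj₁ (all-ones ones-only)
  rest = proj₂ (all-ones ones-only)
sorted-split {suc (suc x) ∷ π} l (_ ∷ ps) = cong (suc (suc x) ∷_) (sorted-split (Linked.tail l) ps)

fromMults-toMults : ∀ d {π} → Linked _≥_ π → All (1 ≤_) π → All (_≤ d) π → fromMults (toMults d π) ≡ π
fromMults-toMults zero    _ []        _         = refl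
fromMults-toMults zero    _ (1≤x ∷ _) (x≤0 ∷ _) = ⊥-elim (<-irrefl refl (≤-trans 1≤x x≤0))
fromMults-toMults (suc d) {π} l ps bounded = begin
  map suc (fromMults (toMults d (dropFirstColumn π))) ++ replicate (ones π) 1
    ≡⟨ cong (λ c → map suc c ++ replicate (ones π) 1) (fromMults-toMults d
         (dropFirstColumn-sorted l) (dropFirstColumn-positive π) (dropFirstColumn-bounded bounded)) ⟩
  map suc (dropFirstColumn π) ++ replicate (ones π) 1
    ≡⟨ sorted-split l ps ⟩
  π ∎
  where open ≡-Reasoning


-- Conjugation

tallerThan : ℕ → List ℕ → ℕ
tallerThan j xs = length (filter (suc j ≤?_) xs)

conj-tallerThan : ∀ xs → conj xs ≡ applyUpTo (λ j → tallerThan j xs) (part xs 1)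
conj-tallerThan xs = map-upTo _ (part xs 1)

tallerThan-accept : ∀ {j x} xs → j < x → tallerThan j (x ∷ xs) ≡ suc (tallerThan j xs)
tallerThan-accept _ j<x = cong length (filter-accept (_ ≤?_) j<x)

tallerThan-reject : ∀ {j x} xs → x ≤ j → tallerThan j (x ∷ xs) ≡ tallerThan j xs
tallerThan-reject _ x≤j = cong length (filter-reject (_ ≤?_) (≤⇒≯ x≤j))

tallerThan-none : ∀ {m} j {xs} → All (_≤ m) xs → m ≤ j → tallerThan j xs ≡ 0
tallerThan-none j b m≤j = cong length (filter-none (_ ≤?_) (All.map (λ x≤m → ≤⇒≯ (≤-trans x≤m m≤j)) b))

tallerThan-++ : ∀ j xs ys → tallerThan j (xs ++ ys) ≡ tallerThan j xs + tallerThan j ys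
tallerThan-++ j xs ys = trans (cong length (filter-++ (_ ≤?_) xs ys)) (length-++ (filter (_ ≤?_) xs))

tallerThan-map-+ : ∀ d j xs → tallerThan (d + j) (map (d +_) xs) ≡ tallerThan j xs
tallerThan-map-+ d j []       = refl
tallerThan-map-+ d j (x ∷ xs) with suc j ≤? x
... | yes j<x = begin
  tallerThan (d + j) (d + x ∷ map (d +_) xs)  ≡⟨ tallerThan-accept _ (+-monoʳ-< d j<x) ⟩
  suc (tallerThan (d + j) (map (d +_) xs))    ≡⟨ cong suc (tallerThan-map-+ d j xs) ⟩
  suc (tallerThan j xs)                       ≡⟨ tallerThan-accept xs j<x ⟨
  tallerThan j (x ∷ xs)                       ∎
  where open ≡-Reasoning
... | no  j≮x = begin
  tallerThan (d + j) (d + x ∷ map (d +_) xs)  ≡⟨ tallerThan-reject _ (+-monoʳ-≤ d (≮⇒≥ j≮x)) ⟩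
  tallerThan (d + j) (map (d +_) xs)          ≡⟨ tallerThan-map-+ d j xs ⟩
  tallerThan j xs                             ≡⟨ tallerThan-reject xs (≮⇒≥ j≮x) ⟨
  tallerThan j (x ∷ xs)                       ∎
  where open ≡-Reasoning

conj-suffixSums : ∀ s → conj (suffixSums s) ≡ fromMults s
conj-suffixSums []      = refl
conj-suffixSums (v ∷ s) = begin
  conj (suffixSums (v ∷ s))                  ≡⟨ conj-tallerThan (suffixSums (v ∷ s)) ⟩
  applyUpTo g (v + S)                        ≡⟨ cong (applyUpTo g) (+-comm v S) ⟩
  applyUpTo g (S + v)                        ≡⟨ applyUpTo-+ g S v ⟩
  applyUpTo g S ++ applyUpTo (g ∘ (S +_)) v  ≡⟨ cong₂ _++_ below above ⟩
  map suc (fromMults s) ++ replicate v 1     ∎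
  where
  open ≡-Reasoning
  S = sum s
  h : ℕ → ℕ
  h j = tallerThan j (suffixSums s)
  g : ℕ → ℕ
  g j = tallerThan j ((v + S) ∷ suffixSums s)
  below : applyUpTo g S ≡ map suc (fromMults s)
  below = begin
    applyUpTo g S
      ≡⟨ applyUpTo-cong S (λ j<S → tallerThan-accept (suffixSums s) (≤-trans j<S (m≤n+m S v))) ⟩
    applyUpTo (suc ∘ h) S
      ≡⟨ map-applyUpTo h suc S ⟨
    map suc (applyUpTo h S)
      ≡⟨ cong (λ n → map suc (applyUpTo h n)) (part₁-suffixSums s) ⟨
    map suc (applyUpTo h (part (suffixSums s) 1))
      ≡⟨ cong (map suc) (conj-tallerThan (suffixSums s)) ⟨
    map suc (conj (suffixSums s))
      ≡⟨ cong (map suc) (conj-suffixSums s) ⟩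
    map suc (fromMults s)
      ∎
  above : applyUpTo (g ∘ (S +_)) v ≡ replicate v 1
  above = trans (applyUpTo-cong v (λ {i} i<v → trans
      (tallerThan-accept (suffixSums s) (subst (S + i <_) (+-comm S v) (+-monoʳ-< S i<v)))
      (cong suc (tallerThan-none (S + i) (suffixSums-bounded s) (m≤m+n S i)))))
    (applyUpTo-const 1 v)


disjointSupports : List ℕ → List ℕ → Bool
disjointSupports (a ∷ p) (b ∷ s) = disjointSupports p s ∧ ((a ≡ᵇ 0) ∨ (b ≡ᵇ 0))
disjointSupports _       _       = true

elemᵇ-++ : ∀ x xs ys → elemᵇ x (xs ++ ys) ≡ elemᵇ x xs ∨ elemᵇ x ys
elemᵇ-++ x []       ys = refl
elemᵇ-++ x (y ∷ xs) ys = trans (cong ((x ≡ᵇ y) ∨_) (elemᵇ-++ x xs ys)) (sym (∨-assoc (x ≡ᵇ y) _ _))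

elemᵇ-map-suc : ∀ x ys → elemᵇ (suc x) (map suc ys) ≡ elemᵇ x ys
elemᵇ-map-suc x []       = refl
elemᵇ-map-suc x (y ∷ ys) = cong ((x ≡ᵇ y) ∨_) (elemᵇ-map-suc x ys)

elemᵇ-replicate-1 : ∀ {x} n → 2 ≤ x → elemᵇ x (replicate n 1) ≡ false
elemᵇ-replicate-1               zero    _             = refl
elemᵇ-replicate-1 {suc (suc _)} (suc n) (s≤s (s≤s _)) = elemᵇ-replicate-1 n (s≤s (s≤s z≤n))

elemᵇ-1-map-suc : ∀ {ys} → All (1 ≤_) ys → elemᵇ 1 (map suc ys) ≡ false
elemᵇ-1-map-suc []             = refl
elemᵇ-1-map-suc (s≤s z≤n ∷ ps) = elemᵇ-1-map-suc ps

disjointᵇ-++ : ∀ xs ys zs → disjointᵇ (xs ++ ys) zs ≡ disjointᵇ xs zs ∧ disjointᵇ ys zs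
disjointᵇ-++ []       ys zs = refl
disjointᵇ-++ (x ∷ xs) ys zs =
  trans (cong (not (elemᵇ x zs) ∧_) (disjointᵇ-++ xs ys zs)) (sym (∧-assoc (not (elemᵇ x zs)) _ _))

disjointᵇ-map-suc : ∀ {xs} ys n → All (1 ≤_) xs →
                    disjointᵇ (map suc xs) (map suc ys ++ replicate n 1) ≡ disjointᵇ xs ys
disjointᵇ-map-suc         ys n []         = refl
disjointᵇ-map-suc {x ∷ _} ys n (1≤x ∷ ps) = cong₂ (λ a b → not a ∧ b) elem≡ (disjointᵇ-map-suc ys n ps)
  where
  elem≡ : elemᵇ (suc x) (map suc ys ++ replicate n 1) ≡ elemᵇ x ys
  elem≡ = begin
    elemᵇ (suc x) (map suc ys ++ replicate n 1)
      ≡⟨ elemᵇ-++ (suc x) (map suc ys) _ ⟩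
    elemᵇ (suc x) (map suc ys) ∨ elemᵇ (suc x) (replicate n 1)
      ≡⟨ cong₂ _∨_ (elemᵇ-map-suc x ys) (elemᵇ-replicate-1 n (s≤s 1≤x)) ⟩
    elemᵇ x ys ∨ false
      ≡⟨ ∨-identityʳ _ ⟩
    elemᵇ x ys ∎
    where open ≡-Reasoning

disjointᵇ-ones : ∀ m n {ys} → All (1 ≤_) ys →
                 disjointᵇ (replicate m 1) (map suc ys ++ replicate n 1) ≡ (m ≡ᵇ 0) ∨ (n ≡ᵇ 0)
disjointᵇ-ones zero    n       _  = refl
disjointᵇ-ones (suc m) zero {ys} ps =
  trans (cong₂ (λ a b → not a ∧ b) elem≡false (disjointᵇ-ones m zero ps)) (∨-zeroʳ (m ≡ᵇ 0))
  where
  elem≡false : elemᵇ 1 (map suc ys ++ []) ≡ false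
  elem≡false = trans (elemᵇ-++ 1 (map suc ys) []) (cong (_∨ false) (elemᵇ-1-map-suc ps))
disjointᵇ-ones (suc m) (suc n) {ys} ps =
  cong (λ a → not a ∧ disjointᵇ (replicate m 1) (map suc ys ++ replicate (suc n) 1)) elem≡true
  where
  elem≡true : elemᵇ 1 (map suc ys ++ replicate (suc n) 1) ≡ true
  elem≡true = trans (elemᵇ-++ 1 (map suc ys) _) (∨-zeroʳ (elemᵇ 1 (map suc ys)))

disjointᵇ-fromMults : ∀ p s → length p ≡ length s → disjointᵇ (fromMults p) (fromMults s) ≡ disjointSupports p s
disjointᵇ-fromMults []      []      _   = refl
disjointᵇ-fromMults (a ∷ p) (b ∷ s) len = begin
  disjointᵇ (map suc (fromMults p) ++ replicate a 1) (fromMults (b ∷ s))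
    ≡⟨ disjointᵇ-++ (map suc (fromMults p)) (replicate a 1) _ ⟩
  disjointᵇ (map suc (fromMults p)) (fromMults (b ∷ s)) ∧ disjointᵇ (replicate a 1) (fromMults (b ∷ s))
    ≡⟨ cong₂ _∧_ (disjointᵇ-map-suc (fromMults s) b (fromMults-positive p))
                 (disjointᵇ-ones a b (fromMults-positive s)) ⟩
  disjointᵇ (fromMults p) (fromMults s) ∧ ((a ≡ᵇ 0) ∨ (b ≡ᵇ 0))
    ≡⟨ cong (_∧ _) (disjointᵇ-fromMults p s (suc-injective len)) ⟩
  disjointSupports p s ∧ ((a ≡ᵇ 0) ∨ (b ≡ᵇ 0))
    ∎
  where open ≡-Reasoning

support : List ℕ → ℕ
support p = length (filter (1 ≤?_) p)

filter-map-suc : ∀ x ys → filter (¬? ∘ (suc x ≟_)) (map suc ys) ≡ map suc (filter (¬? ∘ (x ≟_)) ys)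
filter-map-suc x []       = refl
filter-map-suc x (y ∷ ys) with x ≟ y
... | yes refl = begin
  filter (¬? ∘ (suc x ≟_)) (suc x ∷ map suc ys)  ≡⟨ filter-reject (¬? ∘ (suc x ≟_)) (λ x≢x → x≢x refl) ⟩
  filter (¬? ∘ (suc x ≟_)) (map suc ys)          ≡⟨ filter-map-suc x ys ⟩
  map suc (filter (¬? ∘ (x ≟_)) ys)              ≡⟨ cong (map suc) (filter-reject (¬? ∘ (x ≟_)) (λ x≢x → x≢x refl)) ⟨
  map suc (filter (¬? ∘ (x ≟_)) (x ∷ ys))        ∎
  where open ≡-Reasoning
... | no  x≢y = begin
  filter (¬? ∘ (suc x ≟_)) (suc y ∷ map suc ys)   ≡⟨ filter-accept (¬? ∘ (suc x ≟_)) (x≢y ∘ suc-injective) ⟩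
  suc y ∷ filter (¬? ∘ (suc x ≟_)) (map suc ys)   ≡⟨ cong (suc y ∷_) (filter-map-suc x ys) ⟩
  map suc (y ∷ filter (¬? ∘ (x ≟_)) ys)           ≡⟨ cong (map suc) (filter-accept (¬? ∘ (x ≟_)) x≢y) ⟨
  map suc (filter (¬? ∘ (x ≟_)) (y ∷ ys))         ∎
  where open ≡-Reasoning

deduplicate-map-suc : ∀ xs → deduplicate _≟_ (map suc xs) ≡ map suc (deduplicate _≟_ xs)
deduplicate-map-suc []       = refl
deduplicate-map-suc (x ∷ xs) = cong (suc x ∷_)
  (trans (cong (filter (¬? ∘ (suc x ≟_))) (deduplicate-map-suc xs)) (filter-map-suc x (deduplicate _≟_ xs)))

deduplicate-++ : ∀ xs ys → All (λ x → All (x ≢_) ys) xs →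
                 deduplicate _≟_ (xs ++ ys) ≡ deduplicate _≟_ xs ++ deduplicate _≟_ ys
deduplicate-++ []       ys _              = refl
deduplicate-++ (x ∷ xs) ys (x∉ys ∷ xs∉ys) = cong (x ∷_) (begin
  filter P (deduplicate _≟_ (xs ++ ys))                          ≡⟨ cong (filter P) (deduplicate-++ xs ys xs∉ys) ⟩
  filter P (deduplicate _≟_ xs ++ deduplicate _≟_ ys)            ≡⟨ filter-++ P (deduplicate _≟_ xs) _ ⟩
  filter P (deduplicate _≟_ xs) ++ filter P (deduplicate _≟_ ys) ≡⟨ cong (filter P (deduplicate _≟_ xs) ++_)
                                                                       (filter-all P (All.deduplicate⁺ _≟_ x∉ys)) ⟩
  filter P (deduplicate _≟_ xs) ++ deduplicate _≟_ ys            ∎)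
  where
  open ≡-Reasoning
  P = ¬? ∘ (x ≟_)

length-deduplicate-replicate : ∀ n x → length (deduplicate _≟_ (replicate n x)) ≡ support (n ∷ [])
length-deduplicate-replicate zero    x = refl
length-deduplicate-replicate (suc n) x =
  cong (suc ∘ length) (filter-none (¬? ∘ (x ≟_)) (All.deduplicate⁺ _≟_ (All.replicate⁺ n λ x≢x → x≢x refl)))

distinctSizes-fromMults : ∀ p → distinctSizes (fromMults p) ≡ support p
distinctSizes-fromMults []      = refl
distinctSizes-fromMults (v ∷ p) = begin
  length (deduplicate _≟_ (map suc F ++ replicate v 1))
    ≡⟨ cong length (deduplicate-++ (map suc F) (replicate v 1) (All.map⁺ (All.map ≢ones (fromMults-positive p)))) ⟩
  length (deduplicate _≟_ (map suc F) ++ deduplicate _≟_ (replicate v 1))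
    ≡⟨ length-++ (deduplicate _≟_ (map suc F)) ⟩
  length (deduplicate _≟_ (map suc F)) + length (deduplicate _≟_ (replicate v 1))
    ≡⟨ cong₂ _+_ (trans (cong length (deduplicate-map-suc F)) (length-map suc (deduplicate _≟_ F)))
                 (length-deduplicate-replicate v 1) ⟩
  distinctSizes F + support (v ∷ [])
    ≡⟨ cong (_+ support (v ∷ [])) (distinctSizes-fromMults p) ⟩
  support p + support (v ∷ [])
    ≡⟨ +-comm (support p) _ ⟩
  support (v ∷ []) + support p
    ≡⟨ support-∷ v p ⟨
  support (v ∷ p)
    ∎
  where
  open ≡-Reasoning
  F = fromMults p
  ≢ones : ∀ {x} → 1 ≤ x → All (suc x ≢_) (replicate v 1)
  ≢ones (s≤s _) = All.replicate⁺ v λ ()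
  support-∷ : ∀ v p → support (v ∷ p) ≡ support (v ∷ []) + support p
  support-∷ zero    p = refl
  support-∷ (suc v) p = refl


πMults : List ℕ → List ℕ
πMults λs = toMults (durfee λs) (piPart λs)

σMults : List ℕ → List ℕ
σMults λs = differences (map (_∸ durfee λs) (take (durfee λs) λs))

-- σ and π of `assemble d s p` have multiplicities s and p (conj-suffixSums).
assemble : ℕ → List ℕ → List ℕ → List ℕ
assemble d s p = map (d +_) (suffixSums s) ++ fromMults p

part₁-assemble : ∀ {d} s p → length s ≡ d → length p ≡ d → part (assemble d s p) 1 ≡ d + sum s
part₁-assemble []      [] refl refl = refl
part₁-assemble (_ ∷ _) _  _    _    = refl

module _ {d : ℕ} (s p : List ℕ) (s-length : length s ≡ d) (p-length : length p ≡ d) where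

  private
    rows = map (d +_) (suffixSums s)

    suffixSums-length : length (suffixSums s) ≡ d
    suffixSums-length = trans (length-suffixSums s) s-length

    rows-length : length rows ≡ d
    rows-length = trans (length-map (d +_) (suffixSums s)) suffixSums-length

    d≤rows : All (d ≤_) rows
    d≤rows = All.map⁺ (All.universal (m≤m+n d) (suffixSums s))

    π≤d : All (_≤ d) (fromMults p)
    π≤d = subst (λ n → All (_≤ n) (fromMults p)) p-length (fromMults-bounded p)

  assemble-sorted : Linked _≥_ (assemble d s p)
  assemble-sorted = Linked-++ (Linked.map⁺ (Linked.map (+-monoʳ-≤ d) (suffixSums-sorted s)))
    (fromMults-sorted p) d≤rows π≤d

  assemble-positive : All (1 ≤_) (assemble d s p)
  assemble-positive = All.++⁺ (rows-positive s s-length) (fromMults-positive p)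
    where
    rows-positive : ∀ s → length s ≡ d → All (1 ≤_) (map (d +_) (suffixSums s))
    rows-positive []      _    = []
    rows-positive (_ ∷ s) refl = All.map⁺ (All.universal (λ _ → s≤s z≤n) (suffixSums (_ ∷ s)))

  durfee-assemble : durfee (assemble d s p) ≡ d
  durfee-assemble = durfee-unique assemble-sorted (DurfeeSide-++ rows-length d≤rows π≤d)

  sum-assemble : sum (assemble d s p) ≡ d * d + (weight s + weight p)
  sum-assemble = begin
    sum (rows ++ fromMults p)                          ≡⟨ sum-++ rows (fromMults p) ⟩
    sum rows + sum (fromMults p)                       ≡⟨ cong₂ _+_ (sum-map-shift d (suffixSums s)) (sum-fromMults p) ⟩
    length (suffixSums s) * d + weight s + weight p    ≡⟨ cong (λ l → l * d + weight s + weight p) suffixSums-length ⟩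
    d * d + weight s + weight p                        ≡⟨ +-assoc (d * d) (weight s) (weight p) ⟩
    d * d + (weight s + weight p)                      ∎
    where open ≡-Reasoning

  σMults-assemble : σMults (assemble d s p) ≡ s
  σMults-assemble = begin
    differences (map (_∸ durfee (assemble d s p)) (take (durfee (assemble d s p)) (assemble d s p)))
      ≡⟨ cong (λ e → differences (map (_∸ e) (take e (assemble d s p)))) durfee-assemble ⟩
    differences (map (_∸ d) (take d (rows ++ fromMults p)))
      ≡⟨ cong (differences ∘ map (_∸ d)) (take-++ rows (fromMults p) rows-length) ⟩
    differences (map (_∸ d) (map (d +_) (suffixSums s)))
      ≡⟨ cong differences (map-∸-+ d (suffixSums s)) ⟩
    differences (suffixSums s)
      ≡⟨ differences-suffixSums s ⟩
    s ∎
    where open ≡-Reasoning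

  piPart-assemble : piPart (assemble d s p) ≡ fromMults p
  piPart-assemble = trans (cong (λ n → drop n (assemble d s p)) durfee-assemble) (drop-++ rows (fromMults p) rows-length)

  sigmaPart-assemble : sigmaPart (assemble d s p) ≡ fromMults s
  sigmaPart-assemble = begin
    drop (durfee (assemble d s p)) (conj (assemble d s p))
      ≡⟨ cong (λ n → drop n (conj (assemble d s p))) durfee-assemble ⟩
    drop d (conj (assemble d s p))
      ≡⟨ cong (drop d) (conj-tallerThan (assemble d s p)) ⟩
    drop d (applyUpTo g (part (assemble d s p) 1))
      ≡⟨ cong (drop d ∘ applyUpTo g) (part₁-assemble s p s-length p-length) ⟩
    drop d (applyUpTo g (d + sum s))
      ≡⟨ cong (drop d) (applyUpTo-+ g d (sum s)) ⟩
    drop d (applyUpTo g d ++ applyUpTo (g ∘ (d +_)) (sum s))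
      ≡⟨ drop-++ (applyUpTo g d) _ (length-applyUpTo g d) ⟩
    applyUpTo (g ∘ (d +_)) (sum s)
      ≡⟨ applyUpTo-cong (sum s) (λ {j} _ → columns j) ⟩
    applyUpTo (λ j → tallerThan j (suffixSums s)) (sum s)
      ≡⟨ cong (applyUpTo _) (part₁-suffixSums s) ⟨
    applyUpTo (λ j → tallerThan j (suffixSums s)) (part (suffixSums s) 1)
      ≡⟨ conj-tallerThan (suffixSums s) ⟨
    conj (suffixSums s)
      ≡⟨ conj-suffixSums s ⟩
    fromMults s
      ∎
    where
    open ≡-Reasoning
    g : ℕ → ℕ
    g j = tallerThan j (assemble d s p)
    columns : ∀ j → tallerThan (d + j) (assemble d s p) ≡ tallerThan j (suffixSums s)
    columns j = begin
      tallerThan (d + j) (rows ++ fromMults p)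
        ≡⟨ tallerThan-++ (d + j) rows (fromMults p) ⟩
      tallerThan (d + j) rows + tallerThan (d + j) (fromMults p)
        ≡⟨ cong₂ _+_ (tallerThan-map-+ d j (suffixSums s)) (tallerThan-none (d + j) π≤d (m≤m+n d j)) ⟩
      tallerThan j (suffixSums s) + 0
        ≡⟨ +-identityʳ _ ⟩
      tallerThan j (suffixSums s)
        ∎

  πMults-assemble : πMults (assemble d s p) ≡ p
  πMults-assemble = trans (cong₂ toMults durfee-assemble piPart-assemble) (toMults-fromMults p p-length)

  isBasis-assemble : isBasis (assemble d s p) ≡ disjointSupports p s
  isBasis-assemble = trans (cong₂ disjointᵇ piPart-assemble sigmaPart-assemble)
                           (disjointᵇ-fromMults p s (trans p-length (sym s-length)))

σMults-length : ∀ λs → length (σMults λs) ≡ durfee λs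
σMults-length λs = begin
  length (differences (map (_∸ d) (take d λs)))  ≡⟨ length-differences (map (_∸ d) (take d λs)) ⟩
  length (map (_∸ d) (take d λs))                ≡⟨ length-map (_∸ d) (take d λs) ⟩
  length (take d λs)                             ≡⟨ length-take d λs ⟩
  d ⊓ length λs                                  ≡⟨ m≤n⇒m⊓n≡m (DurfeeSide-length {λs} (durfee-side λs)) ⟩
  d                                              ∎
  where
  open ≡-Reasoning
  d = durfee λs

πMults-length : ∀ λs → length (πMults λs) ≡ durfee λs
πMults-length λs = length-toMults (durfee λs) (piPart λs)

module _ {λs : List ℕ} (sorted : Linked _≥_ λs) (positive : All (1 ≤_) λs) where

  private
    d = durfee λs
    d≤part = proj₁ (durfee-side λs)
    part≤d = proj₂ (durfee-side λs)

    d≤top : All (d ≤_) (take d λs)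
    d≤top = All.map (≤-trans d≤part) (take-≥-part sorted d)

  assemble-mults : assemble d (σMults λs) (πMults λs) ≡ λs
  assemble-mults = begin
    map (d +_) (suffixSums (σMults λs)) ++ fromMults (πMults λs)
      ≡⟨ cong₂ _++_ (cong (map (d +_)) (suffixSums-differences
           (Linked.map⁺ (Linked.map (∸-monoˡ-≤ d) (take-sorted d sorted))))) π≡ ⟩
    map (d +_) (map (_∸ d) (take d λs)) ++ drop d λs
      ≡⟨ cong (_++ drop d λs) (map-+-∸ d≤top) ⟩
    take d λs ++ drop d λs
      ≡⟨ take++drop≡id d λs ⟩
    λs ∎
    where
    open ≡-Reasoning
    π≡ : fromMults (πMults λs) ≡ drop d λs
    π≡ = fromMults-toMults d (drop-sorted d sorted) (All.drop⁺ d positive)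
           (All.map (λ le → ≤-trans le part≤d) (drop-≤-part sorted d))


-- Basis partitions and codes

σMult : ℕ × Color → ℕ
σMult (m , red)   = m
σMult (_ , green) = 0

πMult : ℕ × Color → ℕ
πMult (_ , red)   = 0
πMult (m , green) = suc m

toPartition : Code → List ℕ
toPartition D = assemble (length D) (map σMult D) (map πMult D)

codeOf : List ℕ → List ℕ → Code
codeOf (zero  ∷ p) (m ∷ s) = (m , red)   ∷ codeOf p s
codeOf (suc m ∷ p) (_ ∷ s) = (m , green) ∷ codeOf p s
codeOf _           _       = []

fromPartition : List ℕ → Code
fromPartition λs = codeOf (πMults λs) (σMults λs)

codeOf-mults : ∀ D → codeOf (map πMult D) (map σMult D) ≡ D
codeOf-mults []                = refl
codeOf-mults ((m , red)   ∷ D) = cong ((m , red) ∷_) (codeOf-mults D)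
codeOf-mults ((m , green) ∷ D) = cong ((m , green) ∷_) (codeOf-mults D)

length-codeOf : ∀ p s → length p ≡ length s → length (codeOf p s) ≡ length p
length-codeOf []          []      _   = refl
length-codeOf (zero  ∷ p) (_ ∷ s) len = cong suc (length-codeOf p s (suc-injective len))
length-codeOf (suc _ ∷ p) (_ ∷ s) len = cong suc (length-codeOf p s (suc-injective len))

πMult-codeOf : ∀ p s → length p ≡ length s → map πMult (codeOf p s) ≡ p
πMult-codeOf []          []      _   = refl
πMult-codeOf (zero  ∷ p) (_ ∷ s) len = cong (0 ∷_) (πMult-codeOf p s (suc-injective len))
πMult-codeOf (suc m ∷ p) (_ ∷ s) len = cong (suc m ∷_) (πMult-codeOf p s (suc-injective len))

σMult-codeOf : ∀ p s → length p ≡ length s → T (disjointSupports p s) → map σMult (codeOf p s) ≡ s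
σMult-codeOf []          []          _   _ = refl
σMult-codeOf (zero  ∷ p) (m ∷ s)     len t = cong (m ∷_) (σMult-codeOf p s (suc-injective len) (proj₁ (T-∧⁻ t)))
σMult-codeOf (suc _ ∷ p) (zero ∷ s)  len t = cong (0 ∷_) (σMult-codeOf p s (suc-injective len) (proj₁ (T-∧⁻ t)))
σMult-codeOf (suc _ ∷ p) (suc _ ∷ s) _   t = ⊥-elim (proj₂ (T-∧⁻ t))

disjointSupports-mults : ∀ D → T (disjointSupports (map πMult D) (map σMult D))
disjointSupports-mults []                = _
disjointSupports-mults ((_ , red)   ∷ D) = T-∧⁺ (disjointSupports-mults D) _
disjointSupports-mults ((_ , green) ∷ D) = T-∧⁺ (disjointSupports-mults D) _

support-πMult : ∀ D → support (map πMult D) ≡ numGreen D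
support-πMult []                = refl
support-πMult ((_ , red)   ∷ D) = support-πMult D
support-πMult ((_ , green) ∷ D) = cong suc (support-πMult D)

mult≡σMult+πMult : ∀ e → mult e ≡ σMult e + πMult e
mult≡σMult+πMult (m , red)   = sym (+-identityʳ m)
mult≡σMult+πMult (m , green) = refl

isBasisOf : ℕ → ℕ → ℕ → List ℕ → Bool
isBasisOf n k ℓ λs =
  isPartition λs ∧ (sum λs ≡ᵇ n) ∧ (durfee λs ≡ᵇ (k + ℓ)) ∧ isBasis λs ∧ (distinctSizes (piPart λs) ≡ᵇ ℓ)

module _ (D : Code) where

  private
    σ = map σMult D
    π = map πMult D
    σ-length = length-map σMult D
    π-length = length-map πMult D

  sum-toPartition : sum (toPartition D) ≡ length D * length D + weight (map mult D)
  sum-toPartition = trans (sum-assemble σ π σ-length π-length) (cong (length D * length D +_) weights)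
    where
    weights : weight σ + weight π ≡ weight (map mult D)
    weights = sym (trans (cong weight (map-cong mult≡σMult+πMult D)) (weight-map-+ σMult πMult D))

  isPartition-toPartition : T (isPartition (toPartition D))
  isPartition-toPartition = T-∧⁺ (All⇒allPositive (assemble-positive σ π σ-length π-length))
                                 (Linked⇒nonIncreasing (assemble-sorted σ π σ-length π-length))

  isBasis-toPartition : T (isBasis (toPartition D))
  isBasis-toPartition = subst T (sym (isBasis-assemble σ π σ-length π-length)) (disjointSupports-mults D)

  distinctSizes-toPartition : distinctSizes (piPart (toPartition D)) ≡ numGreen D
  distinctSizes-toPartition = trans (cong distinctSizes (piPart-assemble σ π σ-length π-length))
                                    (trans (distinctSizes-fromMults π) (support-πMult D))

  isBasisOf-toPartition : ∀ n k ℓ → isBasisOf n k ℓ (toPartition D) ≡ isCodeOf n k ℓ D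
  isBasisOf-toPartition n k ℓ
    rewrite Equivalence.to T-≡ isPartition-toPartition | Equivalence.to T-≡ isBasis-toPartition
          | sum-toPartition | distinctSizes-toPartition | durfee-assemble σ π σ-length π-length
          = cong ((length D * length D + weight (map mult D) ≡ᵇ n) ∧_)
              (trans (cong (λ l → (l ≡ᵇ k + ℓ) ∧ (numGreen D ≡ᵇ ℓ)) (length≡numRed+numGreen D))
                     (+-≡ᵇ-∧ (numRed D) (numGreen D) k ℓ))

  fromPartition-toPartition : fromPartition (toPartition D) ≡ D
  fromPartition-toPartition = trans (cong₂ codeOf (πMults-assemble σ π σ-length π-length)
                                                  (σMults-assemble σ π σ-length π-length))
                                    (codeOf-mults D)

toPartition-fromPartition : ∀ {λs} → T (isPartition λs) → T (isBasis λs) → toPartition (fromPartition λs) ≡ λs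
toPartition-fromPartition {λs} partition basis = begin
  assemble (length (codeOf p s)) (map σMult (codeOf p s)) (map πMult (codeOf p s))
    ≡⟨ cong (λ e → assemble e (map σMult (codeOf p s)) (map πMult (codeOf p s)))
            (trans (length-codeOf p s p≡s) (πMults-length λs)) ⟩
  assemble (durfee λs) (map σMult (codeOf p s)) (map πMult (codeOf p s))
    ≡⟨ cong₂ (assemble (durfee λs)) (σMult-codeOf p s p≡s supports) (πMult-codeOf p s p≡s) ⟩
  assemble (durfee λs) s p
    ≡⟨ assemble-mults sorted positive ⟩
  λs ∎
  where
  open ≡-Reasoning
  p = πMults λs
  s = σMults λs
  positive = allPositive⇒All λs (proj₁ (T-∧⁻ partition))
  sorted = nonIncreasing⇒Linked λs (proj₂ (T-∧⁻ partition))
  p≡s : length p ≡ length s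
  p≡s = trans (πMults-length λs) (sym (σMults-length λs))
  supports : T (disjointSupports p s)
  supports = subst T (trans (cong isBasis (sym (assemble-mults sorted positive)))
                            (isBasis-assemble s p (σMults-length λs) (πMults-length λs))) basis

CodeSet↔BasisSet : ∀ n k ℓ → CodeSet n k ℓ ↔ BasisSet n k ℓ
CodeSet↔BasisSet n k ℓ =
  Σ-T-↔ toPartition fromPartition (λ D → isBasisOf-toPartition D n k ℓ) fromPartition-toPartition
  (λ {λs} t → let partition , sum-durfee-basis = T-∧⁻ {isPartition λs} t
                  _ , durfee-basis = T-∧⁻ {sum λs ≡ᵇ n} sum-durfee-basis
                  _ , basis-distinct = T-∧⁻ {durfee λs ≡ᵇ k + ℓ} durfee-basis
              in toPartition-fromPartition partition (proj₁ (T-∧⁻ {isBasis λs} basis-distinct)))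

theorem1p5 : (n k ℓ : ℕ) → BasisSet n k ℓ ↔ L2Set n k ℓ
theorem1p5 n k ℓ = ↔-trans (↔-sym (CodeSet↔BasisSet n k ℓ)) (CodeSet↔L2Set n k ℓ)
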